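{- Let $t$ be a positive integer and let $G_1,G_2,\ldots,G_n$ be graphs. If $G$ and $H$ are both $t$-connected sums of $G_1,G_2,\ldots,G_n$, then $b_k(G)=b_k(H)$ for all nonnegative integers $k$.
   Context: All graphs are simple. For a graph $G$ with vertex set $V$ and $W\subset V$, $G|_W$ is the induced subgraph on $W$, and $\mathrm{nc}(G|_W)$ is its number of connected components (so $\mathrm{nc}(G|_\emptyset)=0$). Define $b_k(G)=\sum_{W\subset V,\,|W|=k}(\mathrm{nc}(G|_W)-1)$. Connected sum of two graphs: let $G_1,G_2$ be graphs with vertex sets $V_1,V_2$ and edge sets $E_1,E_2$; let $F_1\subset V_1$, $F_2\subset V_2$ with $|F_1|=|F_2|=t$ such that $G_1|_{F_1}$ and $G_2|_{F_2}$ are complete graphs; let $\sigma:V_2\to V_2'$ be a bijection onto a finite set $V_2'$ with $V_1\cap V_2'=F_1$ and $\sigma(F_2)=F_1$. The graph with vertex set $V_1\cup V_2'$ and edge set $E_1\cup\{\{\sigma(x),\sigma(y)\}:\{x,y\}\in E_2\}$ is called a $t$-connected sum of $G_1$ and $G_2$. A graph $G$ is a $t$-connected sum of $G_1,\ldots,G_n$ if there are graphs $G_1',\ldots,G_n'$ with $G_1'=G_1$, $G_i'$ a $t$-connected sum of $G_{i-1}'$ and $G_i$ for $i=2,\ldots,n$, and $G_n'=G$. -}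

module Defs where

open import Data.Bool using (Bool; true; false; _∧_; _∨_; not; if_then_else_)
open import Data.Nat using (ℕ; zero; suc; _<ᵇ_)
open import Data.Fin using (Fin; toℕ)
open import Data.Fin.Subset using (Subset; inside; outside; ∣_∣)
open import Data.Vec using (Vec; []; _∷_; lookup)
open import Data.List using (List; []; _∷_; _∷ʳ_; map; _++_; allFin; filter)
open import Data.Bool.ListAction using (any; all)
import Data.List as L
open import Data.Integer using (ℤ; +_; _-_) renaming (_+_ to _+ℤ_)
open import Data.Nat using (_≟_)
open import Data.Product using (Σ; _×_; ∃; ∃-syntax; _,_)
open import Data.Sum using (_⊎_)
open import Relation.Binary.PropositionalEquality using (_≡_; _≢_)
open import Relation.Nullary.Decidable using (isYes)
open import Function using (_⇔_)

record Graph : Set where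
  field
    size        : ℕ
    adj         : Fin size → Fin size → Bool
    symmetric   : ∀ x y → adj x y ≡ adj y x
    irreflexive : ∀ x → adj x x ≡ false
open Graph public

-- reach G W i x y : y is reachable from x by a walk of length ≤ i
-- all of whose vertices lie in W (x itself is assumed to be in W).
reach : (G : Graph) → Subset (size G) → ℕ → Fin (size G) → Fin (size G) → Bool
reach G W zero    x y = isYes (toℕ x ≟ toℕ y)
reach G W (suc i) x y =
  reach G W i x y ∨
  any (λ z → lookup W z ∧ reach G W i x z ∧ adj G z y ∧ lookup W y) (allFin (size G))

connectedIn : (G : Graph) → Subset (size G) → Fin (size G) → Fin (size G) → Bool
connectedIn G W x y = lookup W x ∧ lookup W y ∧ reach G W (size G) x y

isRep : (G : Graph) → Subset (size G) → Fin (size G) → Bool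
isRep G W x = lookup W x ∧
  all (λ y → not ((toℕ y <ᵇ toℕ x) ∧ connectedIn G W y x)) (allFin (size G))

nc : (G : Graph) → Subset (size G) → ℕ
nc G W = L.length (L.filter (λ x → Data.Bool._≟_ (isRep G W x) true) (allFin (size G)))
  where import Data.Bool

allSubsets : (n : ℕ) → List (Subset n)
allSubsets zero    = [] ∷ []
allSubsets (suc n) = map (outside ∷_) (allSubsets n) ++ map (inside ∷_) (allSubsets n)

sumℤ : List ℤ → ℤ
sumℤ = L.foldr _+ℤ_ (+ 0)

b : ℕ → Graph → ℤ
b k G = sumℤ (map (λ W → (+ nc G W) - (+ 1))
                  (filter (λ W → ∣ W ∣ ≟ k) (allSubsets (size G))))

IsClique : (G : Graph) → Subset (size G) → Set
IsClique G F = ∀ x y → lookup F x ≡ true → lookup F y ≡ true → x ≢ y → adj G x y ≡ true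

-- G is a t-connected sum of G₁ and G₂.  The vertex set V₁ ∪ V₂' of the
-- paper is identified with Fin (size G): ι₁ is the inclusion V₁ → V₁ ∪ V₂'
-- and ι₂ = (inclusion V₂' → V₁ ∪ V₂') ∘ σ.
record IsConnSum (t : ℕ) (G₁ G₂ G : Graph) : Set where
  field
    F₁       : Subset (size G₁)
    F₂       : Subset (size G₂)
    |F₁|≡t   : ∣ F₁ ∣ ≡ t
    |F₂|≡t   : ∣ F₂ ∣ ≡ t
    F₁-clique : IsClique G₁ F₁
    F₂-clique : IsClique G₂ F₂
    ι₁       : Fin (size G₁) → Fin (size G)
    ι₂       : Fin (size G₂) → Fin (size G)
    ι₁-inj   : ∀ x x' → ι₁ x ≡ ι₁ x' → x ≡ x'
    ι₂-inj   : ∀ y y' → ι₂ y ≡ ι₂ y' → y ≡ y'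
    covers   : ∀ v → (∃[ x ] ι₁ x ≡ v) ⊎ (∃[ y ] ι₂ y ≡ v)
    -- V₁ ∩ V₂' = F₁
    overlap₁ : ∀ x → lookup F₁ x ≡ true ⇔ (∃[ y ] ι₂ y ≡ ι₁ x)
    -- σ(F₂) = F₁
    overlap₂ : ∀ y → lookup F₂ y ≡ true ⇔ (∃[ x ] lookup F₁ x ≡ true × ι₁ x ≡ ι₂ y)
    edges    : ∀ u v → adj G u v ≡ true ⇔
                 ((∃[ x ] ∃[ x' ] ι₁ x ≡ u × ι₁ x' ≡ v × adj G₁ x x' ≡ true) ⊎
                  (∃[ y ] ∃[ y' ] ι₂ y ≡ u × ι₂ y' ≡ v × adj G₂ y y' ≡ true))

data IsConnSumOf (t : ℕ) : List Graph → Graph → Set where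
  single : ∀ G₁ → IsConnSumOf t (G₁ ∷ []) G₁
  step   : ∀ {Gs G' Gᵢ G} → IsConnSumOf t Gs G' → IsConnSum t G' Gᵢ G →
           IsConnSumOf t (Gs ∷ʳ Gᵢ) G

module Submission where

-- For a single gluing G = G₁ #_t G₂ along the clique F and a set W of
-- vertices, the components of G|_W are those of G₁|_{W∩V₁} and G₂|_{W∩V₂},
-- except that the (at most two) components meeting F merge into one:
--   nc(G|W) - 1 = (nc(G₁|W∩V₁) - 1) + (nc(G₂|W∩V₂) - 1) + [W ∩ F = ∅].
-- Summed over |W| = k, each term depends on W only through its trace on V₁,
-- V₂ or F, and such a sum is a binomial convolution of the graded sum over
-- subsets of V₁, V₂ or F (gsum-restrict).  So b_•(G) is determined by t,
-- |V₁|, |V₂|, b_•(G₁), b_•(G₂), and so is |V| = |V₁| + |V₂| - t; induction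
-- along the iterated sum then shows that b_•(G) depends only on t and the list.

open import Defs
open import Data.Bool using (Bool; true; false; _∧_; _∨_; not; if_then_else_)
import Data.Bool as Bool
open import Data.Bool.Properties using (∨-zeroʳ; T-≡)
open import Data.Bool.ListAction using (any; all)
open import Data.Nat using (ℕ; zero; suc; _+_; _∸_; _≤_; _≥_; z≤n; s≤s; _<ᵇ_)
import Data.Nat as ℕ
open import Data.Nat.Properties
  using (≤-trans; ≤-antisym; ≤-reflexive; m≤n⇒m≤1+n; <-irrefl; <⇒<ᵇ; <ᵇ⇒<;
         +-suc; +-assoc; +-comm; +-identityʳ; +-∸-assoc; m+n∸n≡m; module ≤-Reasoning)
open import Data.Integer using (ℤ; +_; _-_) renaming (_+_ to _+ℤ_)
import Data.Integer.Properties as ℤ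
open import Data.Integer.Tactic.RingSolver using (solve-∀)
open import Algebra.Properties.CommutativeSemigroup ℤ.+-commutativeSemigroup using (interchange)
open import Data.Fin using (Fin; zero; suc; toℕ; splitAt; join; punchIn; punchOut)
import Data.Fin as Fin
open import Data.Fin.Properties
  using (suc-injective; 0≢1+n; toℕ-injective; <-cmp; any?; splitAt-join; join-splitAt;
         punchIn-punchOut; punchInᵢ≢i; punchIn-injective; injective⇒≤)
open import Data.Fin.Subset using (Subset; inside; outside; ∣_∣)
open import Data.Vec using ([]; _∷_; lookup; tabulate; insertAt)
open import Data.Vec.Properties
  using (lookup∘tabulate; tabulate-cong; tabulate∘lookup; insertAt-lookup; insertAt-punchIn)
open import Data.List using (List; []; _∷_; _++_; _∷ʳ_; map; filter; length; allFin; foldl)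
import Data.List as List
open import Data.List.Properties using (filter-++; filter-none; map-++; map-∘; foldl-∷ʳ)
open import Data.List.Membership.Propositional using (lose)
open import Data.List.Membership.Propositional.Properties using (∈-allFin)
open import Data.List.Relation.Unary.Any using (satisfied)
open import Data.List.Relation.Unary.Any.Properties using (any⁺; any⁻)
import Data.List.Relation.Unary.All as All
open import Data.List.Relation.Unary.All.Properties using (all⁺; all⁻)
open import Data.Maybe using (Maybe; just; nothing; fromMaybe; maybe′)
import Data.Maybe as Maybe
open import Data.Product using (∃-syntax; _×_; _,_; proj₁; proj₂)
import Data.Product as Product
open import Data.Sum using (_⊎_; inj₁; inj₂; [_,_]′)
import Data.Sum as Sum
open import Data.Sum.Properties using (inj₁-injective; inj₂-injective)
open import Data.Empty using (⊥; ⊥-elim)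
open import Relation.Nullary using (¬_; does; yes; no; contradiction)
open import Relation.Unary using (Pred; Decidable)
open import Relation.Binary using (tri<; tri≈; tri>)
open import Relation.Binary.PropositionalEquality
open import Function using (_∘_; Equivalence)
open import Level using (0ℓ)

open Equivalence using (to; from)

∧-split : ∀ a {b} → a ∧ b ≡ true → a ≡ true × b ≡ true
∧-split true e = refl , e

∧-intro : ∀ {a b} → a ≡ true → b ≡ true → a ∧ b ≡ true
∧-intro refl refl = refl

true≢false : true ≢ false
true≢false ()

inj₁≢inj₂ : ∀ {A B : Set} {a : A} {b : B} → inj₁ {B = B} a ≢ inj₂ b
inj₁≢inj₂ ()

_⊆ᵇ_ : ∀ {n} → (Fin n → Bool) → (Fin n → Bool) → Set
f ⊆ᵇ g = ∀ x → f x ≡ true → g x ≡ true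

⊆ᵇ-dec : ∀ {n} (f g : Fin n → Bool) → f ⊆ᵇ g ⊎ ∃[ y ] (f y ≡ true × g y ≡ false)
⊆ᵇ-dec {zero}  f g = inj₁ λ ()
⊆ᵇ-dec {suc n} f g with f zero in f0 | g zero in g0 | ⊆ᵇ-dec (f ∘ suc) (g ∘ suc)
... | true  | false | _ = inj₂ (zero , f0 , g0)
... | _     | _     | inj₂ (y , fy , gy) = inj₂ (suc y , fy , gy)
... | true  | true  | inj₁ sub = inj₁ λ { zero _ → g0 ; (suc x) → sub x }
... | false | _     | inj₁ sub = inj₁ λ { zero f0≡t → contradiction (trans (sym f0) f0≡t) λ () ; (suc x) → sub x }

anyFin : ∀ {n} → (Fin n → Bool) → Bool
anyFin {zero}  p = false
anyFin {suc n} p = p zero ∨ anyFin (p ∘ suc)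

anyFin⁺ : ∀ {n} (p : Fin n → Bool) x → p x ≡ true → anyFin p ≡ true
anyFin⁺ p zero    px rewrite px = refl
anyFin⁺ p (suc x) px = trans (cong (p zero ∨_) (anyFin⁺ (p ∘ suc) x px)) (∨-zeroʳ (p zero))

anyFin⁻ : ∀ {n} (p : Fin n → Bool) → anyFin p ≡ true → ∃[ x ] p x ≡ true
anyFin⁻ {suc n} p e with p zero in p0
... | true  = zero , p0
... | false = Product.map suc (λ px → px) (anyFin⁻ (p ∘ suc) e)

anyFin-cong : ∀ {n} {p q : Fin n → Bool} → (∀ x → p x ≡ q x) → anyFin p ≡ anyFin q
anyFin-cong {zero}  p≗q = refl
anyFin-cong {suc n} p≗q = cong₂ _∨_ (p≗q zero) (anyFin-cong (p≗q ∘ suc))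

any-allFin⁺ : ∀ {n} (p : Fin n → Bool) x → p x ≡ true → any p (allFin n) ≡ true
any-allFin⁺ p x px = to T-≡ (any⁺ p (lose (∈-allFin x) (from T-≡ px)))

any-allFin⁻ : ∀ {n} (p : Fin n → Bool) → any p (allFin n) ≡ true → ∃[ x ] p x ≡ true
any-allFin⁻ p e = Product.map₂ (to T-≡) (satisfied (any⁻ p (allFin _) (from T-≡ e)))

all-allFin⁺ : ∀ {n} (p : Fin n → Bool) → (∀ x → p x ≡ true) → all p (allFin n) ≡ true
all-allFin⁺ p h = to T-≡ (all⁻ p {allFin _} (All.tabulate λ {x} _ → from T-≡ (h x)))

all-allFin⁻ : ∀ {n} (p : Fin n → Bool) → all p (allFin n) ≡ true → ∀ x → p x ≡ true
all-allFin⁻ p e x = to T-≡ (All.lookup (all⁺ p _ (from T-≡ e)) (∈-allFin x))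

restrict : ∀ {m n} → (Fin m → Fin n) → Subset n → Subset m
restrict ι W = tabulate (lookup W ∘ ι)

lookup-restrict : ∀ {m n} (ι : Fin m → Fin n) W j → lookup (restrict ι W) j ≡ lookup W (ι j)
lookup-restrict ι W = lookup∘tabulate (lookup W ∘ ι)

image? : ∀ {m n} (ι : Fin m → Fin n) v → (∃[ c ] ι c ≡ v) ⊎ (∀ c → ι c ≢ v)
image? ι v with any? (λ c → ι c Fin.≟ v)
... | yes hit = inj₁ hit
... | no  off = inj₂ λ c e → off (c , e)

bit : Bool → ℕ
bit true  = 1
bit false = 0

count : ∀ {n} → (Fin n → Bool) → ℕ
count {zero}  f = 0
count {suc n} f = bit (f zero) + count (f ∘ suc)

count-≤ : ∀ {n} (f : Fin n → Bool) → count f ≤ n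
count-≤ {zero}  f = z≤n
count-≤ {suc n} f with f zero
... | true  = s≤s (count-≤ (f ∘ suc))
... | false = m≤n⇒m≤1+n (count-≤ (f ∘ suc))

count-true : ∀ n → count {n} (λ _ → true) ≡ n
count-true zero    = refl
count-true (suc n) = cong suc (count-true n)

count-false : ∀ n → count {n} (λ _ → false) ≡ 0
count-false zero    = refl
count-false (suc n) = count-false n

length-filter-tabulate : ∀ {A : Set} {n} (f : A → Bool) (g : Fin n → A) →
  length (filter (λ x → f x Bool.≟ true) (List.tabulate g)) ≡ count (f ∘ g)
length-filter-tabulate {n = zero}  f g = refl
length-filter-tabulate {n = suc n} f g with f (g zero)
... | true  = cong suc (length-filter-tabulate f (g ∘ suc))
... | false = length-filter-tabulate f (g ∘ suc)

MapsTo : ∀ {A B : Set} → (A → Bool) → (B → Bool) → (A → B) → Set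
MapsTo f g φ = ∀ x → f x ≡ true → g (φ x) ≡ true

InjectiveOn : ∀ {A B : Set} → (A → Bool) → (A → B) → Set
InjectiveOn f φ = ∀ x y → f x ≡ true → f y ≡ true → φ x ≡ φ y → x ≡ y

remove : ∀ {n} → Fin n → (Fin n → Bool) → Fin n → Bool
remove z g w = if does (w Fin.≟ z) then false else g w

remove-keeps : ∀ {n} (z : Fin n) g w → g w ≡ true → w ≢ z → remove z g w ≡ true
remove-keeps z g w gw w≢z with w Fin.≟ z
... | yes w≡z = ⊥-elim (w≢z w≡z)
... | no  _   = gw

count-remove : ∀ {n} (z : Fin n) g → g z ≡ true → count g ≡ suc (count (remove z g))
count-remove zero    g gz rewrite gz = refl
count-remove (suc z) g gz =
  trans (cong (λ c → bit (g zero) + c) (count-remove z (g ∘ suc) gz)) (+-suc (bit (g zero)) _)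

count-injection : ∀ {m n} (f : Fin m → Bool) (g : Fin n → Bool) (φ : Fin m → Fin n) →
  MapsTo f g φ → InjectiveOn f φ → count f ≤ count g
count-injection {zero}  f g φ maps inj = z≤n
count-injection {suc m} f g φ maps inj with f zero in f0
... | false = count-injection (f ∘ suc) g (φ ∘ suc) (maps ∘ suc) inj-suc
  where
  inj-suc : InjectiveOn (f ∘ suc) (φ ∘ suc)
  inj-suc x y fx fy e = suc-injective (inj (suc x) (suc y) fx fy e)
... | true = ≤-trans (s≤s (count-injection (f ∘ suc) (remove (φ zero) g) (φ ∘ suc) maps-rest inj-suc))
                     (≤-reflexive (sym (count-remove (φ zero) g (maps zero f0))))
  where
  maps-rest : MapsTo (f ∘ suc) (remove (φ zero) g) (φ ∘ suc)
  maps-rest x fx = remove-keeps (φ zero) g (φ (suc x)) (maps (suc x) fx)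
                     (λ e → 0≢1+n (sym (inj (suc x) zero fx f0 e)))
  inj-suc : InjectiveOn (f ∘ suc) (φ ∘ suc)
  inj-suc x y fx fy e = suc-injective (inj (suc x) (suc y) fx fy e)

count-mono : ∀ {n} (f g : Fin n → Bool) → f ⊆ᵇ g → count f ≤ count g
count-mono f g f⊆g = count-injection f g (λ x → x) f⊆g (λ x y _ _ e → e)

count-strict : ∀ {n} (f g : Fin n → Bool) → f ⊆ᵇ g →
  ∀ y → f y ≡ false → g y ≡ true → suc (count f) ≤ count g
count-strict f g f⊆g zero fy gy rewrite fy | gy = s≤s (count-mono (f ∘ suc) (g ∘ suc) (f⊆g ∘ suc))
count-strict f g f⊆g (suc y) fy gy with f zero in f0 | g zero in g0
... | true  | true  = s≤s (count-strict (f ∘ suc) (g ∘ suc) (f⊆g ∘ suc) y fy gy)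
... | true  | false = contradiction (trans (sym (f⊆g zero f0)) g0) λ ()
... | false | true  = m≤n⇒m≤1+n (count-strict (f ∘ suc) (g ∘ suc) (f⊆g ∘ suc) y fy gy)
... | false | false = count-strict (f ∘ suc) (g ∘ suc) (f⊆g ∘ suc) y fy gy

count⊎ : ∀ {a b} → (Fin a ⊎ Fin b → Bool) → ℕ
count⊎ f = count (f ∘ inj₁) + count (f ∘ inj₂)

count-splitAt : ∀ a {b} (f : Fin a ⊎ Fin b → Bool) → count (f ∘ splitAt a) ≡ count⊎ f
count-splitAt zero    f = refl
count-splitAt (suc a) f =
  trans (cong (λ c → bit (f (inj₁ zero)) + c) (count-splitAt a (f ∘ Sum.map₁ suc)))
        (sym (+-assoc (bit (f (inj₁ zero))) _ _))

count⊎-injection : ∀ {a b c d} (f : Fin a ⊎ Fin b → Bool) (g : Fin c ⊎ Fin d → Bool)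
  (φ : Fin a ⊎ Fin b → Fin c ⊎ Fin d) → MapsTo f g φ → InjectiveOn f φ → count⊎ f ≤ count⊎ g
count⊎-injection {a} {b} {c} {d} f g φ maps inj = begin
  count⊎ f                 ≡⟨ count-splitAt a f ⟨
  count (f ∘ splitAt a)    ≤⟨ count-injection (f ∘ splitAt a) (g ∘ splitAt c) φ′ maps′ inj′ ⟩
  count (g ∘ splitAt c)    ≡⟨ count-splitAt c g ⟩
  count⊎ g                 ∎
  where
  open ≤-Reasoning
  φ′ : Fin (a + b) → Fin (c + d)
  φ′ = join c d ∘ φ ∘ splitAt a
  maps′ : MapsTo (f ∘ splitAt a) (g ∘ splitAt c) φ′
  maps′ x fx = subst (λ z → g z ≡ true) (sym (splitAt-join c d (φ (splitAt a x)))) (maps (splitAt a x) fx)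
  inj′ : InjectiveOn (f ∘ splitAt a) φ′
  inj′ x y fx fy e = trans (sym (join-splitAt a b x))
    (trans (cong (join a b) (inj (splitAt a x) (splitAt a y) fx fy φs≡)) (join-splitAt a b y))
    where
    φs≡ : φ (splitAt a x) ≡ φ (splitAt a y)
    φs≡ = trans (sym (splitAt-join c d _)) (trans (cong (splitAt c) e) (splitAt-join c d _))

count⊎-≡ : ∀ {a b c d} (f : Fin a ⊎ Fin b → Bool) (g : Fin c ⊎ Fin d → Bool)
  (φ : Fin a ⊎ Fin b → Fin c ⊎ Fin d) (ψ : Fin c ⊎ Fin d → Fin a ⊎ Fin b) →
  MapsTo f g φ → InjectiveOn f φ → MapsTo g f ψ → InjectiveOn g ψ → count⊎ f ≡ count⊎ g
count⊎-≡ f g φ ψ mφ iφ mψ iψ =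
  ≤-antisym (count⊎-injection f g φ mφ iφ) (count⊎-injection g f ψ mψ iψ)

least : ∀ {n} → (Fin n → Bool) → Maybe (Fin n)
least {zero}  p = nothing
least {suc n} p = if p zero then just zero else Maybe.map suc (least (p ∘ suc))

data Least {n} (p : Fin n → Bool) : Maybe (Fin n) → Set where
  found : ∀ {u} → p u ≡ true → (∀ y → y Fin.< u → p y ≡ false) → Least p (just u)
  none  : (∀ y → p y ≡ false) → Least p nothing

least-spec : ∀ {n} (p : Fin n → Bool) → Least p (least p)
least-spec {zero}  p = none λ ()
least-spec {suc n} p with p zero in p0
... | true  = found p0 λ _ ()
... | false with least (p ∘ suc) | least-spec (p ∘ suc)
...   | just u  | found pu below = found pu λ { zero _ → p0 ; (suc y) (s≤s y<u) → below y y<u }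
...   | nothing | none  never    = none λ { zero → p0 ; (suc y) → never y }

isLeast : ∀ {n} → (Fin n → Bool) → Fin n → Bool
isLeast p zero    = p zero
isLeast p (suc s) = not (p zero) ∧ isLeast (p ∘ suc) s

isLeast-intro : ∀ {n} (p : Fin n → Bool) u → p u ≡ true →
  (∀ y → y Fin.< u → p y ≡ false) → isLeast p u ≡ true
isLeast-intro p zero    pu below = pu
isLeast-intro p (suc u) pu below rewrite below zero (s≤s z≤n) =
  isLeast-intro (p ∘ suc) u pu λ y y<u → below (suc y) (s≤s y<u)

isLeast-sat : ∀ {n} (p : Fin n → Bool) s → isLeast p s ≡ true → p s ≡ true
isLeast-sat p zero    e = e
isLeast-sat p (suc s) e with p zero
... | false = isLeast-sat (p ∘ suc) s e

isLeast-unique : ∀ {n} (p : Fin n → Bool) s s′ → isLeast p s ≡ true → isLeast p s′ ≡ true → s ≡ s′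
isLeast-unique p zero    zero     _ _ = refl
isLeast-unique p zero    (suc s′) e e′ with p zero
isLeast-unique p zero    (suc s′) e () | true
isLeast-unique p (suc s) zero     e e′ with p zero
isLeast-unique p (suc s) zero     () e′ | true
isLeast-unique p (suc s) (suc s′) e e′ with p zero
... | false = cong suc (isLeast-unique (p ∘ suc) s s′ e e′)

count-isLeast : ∀ {n} (p : Fin n → Bool) → count (isLeast p) ≡ bit (anyFin p)
count-isLeast {zero}  p = refl
count-isLeast {suc n} p with p zero
... | true  = cong suc (count-false n)
... | false = count-isLeast (p ∘ suc)

-- An increasing chain R 0 ⊆ R 1 ⊆ … of subsets of an n-element set whose
-- first member is nonempty, and which never grows again once it has stopped
-- growing, is bounded by its n-th member: it has at most n steps of growth.

module ChainStabilises {n} (R : ℕ → Fin n → Bool)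
  (grows    : ∀ i → R i ⊆ᵇ R (suc i))
  (persists : ∀ i → R (suc i) ⊆ᵇ R i → R (suc (suc i)) ⊆ᵇ R (suc i))
  (x₀ : Fin n) (start : R 0 x₀ ≡ true) where

  Stable : ℕ → Set
  Stable i = R (suc i) ⊆ᵇ R i

  grows-or-stable : ∀ i → suc i ≤ count (R i) ⊎ Stable i
  grows-or-stable zero = inj₁ (subst (λ c → suc c ≤ count (R 0)) (count-false n)
                           (count-strict (λ _ → false) (R 0) (λ _ ()) x₀ refl start))
  grows-or-stable (suc i) with grows-or-stable i
  ... | inj₂ stable = inj₂ (persists i stable)
  ... | inj₁ big with ⊆ᵇ-dec (R (suc i)) (R i)
  ...   | inj₁ stable         = inj₂ (persists i stable)
  ...   | inj₂ (y , new , old) =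
          inj₁ (≤-trans (s≤s big) (count-strict (R i) (R (suc i)) (grows i) y old new))

  stable-at-n : Stable n
  stable-at-n with grows-or-stable n
  ... | inj₁ big    = contradiction (≤-trans big (count-≤ (R n))) λ n<n → <-irrefl refl n<n
  ... | inj₂ stable = stable

  stable-beyond : ∀ k → Stable (k + n)
  stable-beyond zero    = stable-at-n
  stable-beyond (suc k) = persists (k + n) (stable-beyond k)

  collapse : ∀ k → R (k + n) ⊆ᵇ R n
  collapse zero    x r = r
  collapse (suc k) x r = collapse k x (stable-beyond k x r)

  rise : ∀ i k → R i ⊆ᵇ R (k + i)
  rise i zero    x r = r
  rise i (suc k) x r = grows (k + i) x (rise i k x r)

  bounded : ∀ i → R i ⊆ᵇ R n
  bounded i x r = collapse i x (subst (λ j → R j x ≡ true) (+-comm n i) (rise i n x r))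

module Components (G : Graph) (W : Subset (size G)) where

  V : Set
  V = Fin (size G)

  In : V → Set
  In x = lookup W x ≡ true

  -- walks of G|_W starting at x (only the vertices after x are tested)
  data Walk (x : V) : V → Set where
    start : Walk x x
    step  : ∀ {z y} → Walk x z → In z → adj G z y ≡ true → In y → Walk x y

  Connected : V → V → Set
  Connected x y = In x × In y × Walk x y

  _++ʷ_ : ∀ {x z y} → Walk x z → Walk z y → Walk x y
  p ++ʷ start           = p
  p ++ʷ step q wz a wy = step (p ++ʷ q) wz a wy

  reverse : ∀ {x y} → In x → Walk x y → Walk y x
  reverse wx start                 = start
  reverse wx (step {z} {y} p wz a wy) =
    step start wy (trans (symmetric G y z) a) wz ++ʷ reverse wx p

  connected-refl : ∀ {x} → In x → Connected x x
  connected-refl wx = wx , wx , start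

  connected-sym : ∀ {x y} → Connected x y → Connected y x
  connected-sym (wx , wy , p) = wy , wx , reverse wx p

  connected-trans : ∀ {x y z} → Connected x y → Connected y z → Connected x z
  connected-trans (wx , _ , p) (_ , wz , q) = wx , wz , p ++ʷ q

  connected-edge : ∀ {x y} → In x → adj G x y ≡ true → In y → Connected x y
  connected-edge wx a wy = wx , wy , step start wx a wy

  reach-unfold : ∀ i x y → reach G W (suc i) x y ≡ true →
    reach G W i x y ≡ true ⊎
    ∃[ z ] (In z × reach G W i x z ≡ true × adj G z y ≡ true × In y)
  reach-unfold i x y e with reach G W i x y in r
  ... | true  = inj₁ refl
  ... | false with any-allFin⁻ _ e
  ...   | z , q with ∧-split (lookup W z) q
  ...   | wz , q₁ with ∧-split (reach G W i x z) q₁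
  ...   | r′ , q₂ with ∧-split (adj G z y) q₂
  ...   | a , wy = inj₂ (z , wz , r′ , a , wy)

  reach-keep : ∀ i x → reach G W i x ⊆ᵇ reach G W (suc i) x
  reach-keep i x y r rewrite r = refl

  reach-edge : ∀ i x {z y} → In z → reach G W i x z ≡ true → adj G z y ≡ true → In y →
    reach G W (suc i) x y ≡ true
  reach-edge i x {z} {y} wz r a wy =
    trans (cong (reach G W i x y ∨_) (any-allFin⁺ _ z via-z)) (∨-zeroʳ _)
    where
    via-z : (lookup W z ∧ reach G W i x z ∧ adj G z y ∧ lookup W y) ≡ true
    via-z rewrite wz | r | a | wy = refl

  reach-refl : ∀ i x → reach G W i x x ≡ true
  reach-refl zero    x with toℕ x ℕ.≟ toℕ x
  ... | yes _ = refl
  ... | no ne = contradiction refl ne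
  reach-refl (suc i) x = reach-keep i x x (reach-refl i x)

  reach-sound : ∀ i x y → reach G W i x y ≡ true → Walk x y
  reach-sound zero    x y e with toℕ x ℕ.≟ toℕ y
  ... | yes x≡y = subst (Walk x) (toℕ-injective x≡y) start
  reach-sound (suc i) x y e with reach-unfold i x y e
  ... | inj₁ r                      = reach-sound i x y r
  ... | inj₂ (z , wz , r , a , wy) = step (reach-sound i x z r) wz a wy

  walk-reach : ∀ {x y} → Walk x y → ∃[ i ] reach G W i x y ≡ true
  walk-reach {x} start = 0 , reach-refl 0 x
  walk-reach {x} (step p wz a wy) with walk-reach p
  ... | i , r = suc i , reach-edge i x wz r a wy

  -- reach stabilises after size G steps (the chain of reached sets is
  -- increasing and stops growing forever once it stops growing once)
  reach-complete : ∀ {x y} → Walk x y → reach G W (size G) x y ≡ true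
  reach-complete {x} {y} p with walk-reach p
  ... | i , r = ChainStabilises.bounded (λ j → reach G W j x) (λ j → reach-keep j x) persists x
                  (reach-refl 0 x) i y r
    where
    persists : ∀ j → reach G W (suc j) x ⊆ᵇ reach G W j x →
      reach G W (suc (suc j)) x ⊆ᵇ reach G W (suc j) x
    persists j stable y r with reach-unfold (suc j) x y r
    ... | inj₁ r′                     = r′
    ... | inj₂ (z , wz , r′ , a , wy) = reach-edge j x wz (stable z r′) a wy

  connected-sound : ∀ x y → connectedIn G W x y ≡ true → Connected x y
  connected-sound x y e with ∧-split (lookup W x) e
  ... | wx , e′ with ∧-split (lookup W y) e′
  ... | wy , r = wx , wy , reach-sound (size G) x y r

  connected-complete : ∀ {x y} → Connected x y → connectedIn G W x y ≡ true
  connected-complete (wx , wy , p) rewrite wx | wy = reach-complete p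

  connected-self : ∀ {x} → In x → connectedIn G W x x ≡ true
  connected-self wx = connected-complete (connected-refl wx)

  not-connected : ∀ {x y} → connectedIn G W x y ≡ false → ¬ Connected x y
  not-connected e c = contradiction (trans (sym (connected-complete c)) e) λ ()

  IsRep : V → Set
  IsRep x = In x × (∀ y → y Fin.< x → ¬ Connected y x)

  isRep-sound : ∀ x → isRep G W x ≡ true → IsRep x
  isRep-sound x e with ∧-split (lookup W x) e
  ... | wx , e′ = wx , λ y y<x c → no-earlier (all-allFin⁻ _ e′ y)
                                      (to T-≡ (<⇒<ᵇ y<x)) (connected-complete c)
    where
    no-earlier : ∀ {a b} → not (a ∧ b) ≡ true → a ≡ true → b ≡ true → ⊥
    no-earlier {true} {true} () _ _

  isRep-complete : ∀ x → IsRep x → isRep G W x ≡ true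
  isRep-complete x (wx , minimal) =
    trans (cong (_∧ all (λ y → not ((toℕ y <ᵇ toℕ x) ∧ connectedIn G W y x)) (allFin (size G))) wx)
          (all-allFin⁺ _ no-earlier)
    where
    no-earlier : ∀ y → not ((toℕ y <ᵇ toℕ x) ∧ connectedIn G W y x) ≡ true
    no-earlier y with toℕ y <ᵇ toℕ x in lt
    ... | false = refl
    ... | true with connectedIn G W y x in c
    ...   | false = refl
    ...   | true  = contradiction (connected-sound y x c)
                      (minimal y (<ᵇ⇒< _ _ (from T-≡ lt)))

  rep-unique : ∀ {x y} → IsRep x → IsRep y → Connected x y → x ≡ y
  rep-unique {x} {y} (_ , x-min) (_ , y-min) c with <-cmp x y
  ... | tri< x<y _ _ = contradiction c (y-min x x<y)
  ... | tri≈ _ x≡y _ = x≡y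
  ... | tri> _ _ y<x = contradiction (connected-sym c) (x-min y y<x)

  rep : V → V
  rep v = fromMaybe v (least (λ u → connectedIn G W u v))

  rep-spec : ∀ {v} → In v → IsRep (rep v) × Connected (rep v) v
  rep-spec {v} wv with least (λ u → connectedIn G W u v) | least-spec (λ u → connectedIn G W u v)
  ... | just u  | found cu below = (proj₁ c , λ y y<u c′ → not-connected (below y y<u) (connected-trans c′ c)) , c
    where c = connected-sound u v cu
  ... | nothing | none never = ⊥-elim (true≢false (trans (sym (connected-self wv)) (never v)))

  rep-isRep : ∀ {v} → In v → isRep G W (rep v) ≡ true
  rep-isRep wv = isRep-complete _ (proj₁ (rep-spec wv))

  same-rep : ∀ {v v′} → In v → In v′ → rep v ≡ rep v′ → Connected v v′
  same-rep wv wv′ e = connected-trans (connected-sym (proj₂ (rep-spec wv)))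
                        (subst (λ r → Connected r _) (sym e) (proj₂ (rep-spec wv′)))

  nc-count : nc G W ≡ count (isRep G W)
  nc-count = length-filter-tabulate (isRep G W) (λ x → x)

  clique-connected : ∀ {F} → IsClique G F → ∀ {s c} → lookup F s ≡ true → lookup F c ≡ true →
    In s → In c → Connected s c
  clique-connected clique {s} {c} fs fc ws wc with s Fin.≟ c
  ... | yes refl = connected-refl ws
  ... | no  s≢c  = connected-edge ws (clique s c fs fc s≢c) wc

-- A symmetric description of "G is glued from G₁ and G₂ along the cliques
-- F₁ ≅ F₂": the data of a connected sum, in a form invariant under swapping.

record Gluing (G₁ G₂ G : Graph) : Set where
  field
    ι₁ : Fin (size G₁) → Fin (size G)
    ι₂ : Fin (size G₂) → Fin (size G)
    F₁ : Subset (size G₁)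
    F₂ : Subset (size G₂)
    ι₁-injective : ∀ x x′ → ι₁ x ≡ ι₁ x′ → x ≡ x′
    ι₂-injective : ∀ y y′ → ι₂ y ≡ ι₂ y′ → y ≡ y′
    shared₁   : ∀ x y → ι₂ y ≡ ι₁ x → lookup F₁ x ≡ true
    shared₂   : ∀ x y → ι₂ y ≡ ι₁ x → lookup F₂ y ≡ true
    F₁-shared : ∀ x → lookup F₁ x ≡ true → ∃[ y ] ι₂ y ≡ ι₁ x
    F₂-shared : ∀ y → lookup F₂ y ≡ true → ∃[ x ] ι₂ y ≡ ι₁ x
    F₁-clique : IsClique G₁ F₁
    F₂-clique : IsClique G₂ F₂
    edge-origin : ∀ u v → adj G u v ≡ true →
      (∃[ x ] ∃[ x′ ] ι₁ x ≡ u × ι₁ x′ ≡ v × adj G₁ x x′ ≡ true) ⊎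
      (∃[ y ] ∃[ y′ ] ι₂ y ≡ u × ι₂ y′ ≡ v × adj G₂ y y′ ≡ true)
    ι₁-edge : ∀ x x′ → adj G₁ x x′ ≡ true → adj G (ι₁ x) (ι₁ x′) ≡ true
    ι₂-edge : ∀ y y′ → adj G₂ y y′ ≡ true → adj G (ι₂ y) (ι₂ y′) ≡ true
    covers  : ∀ v → (∃[ x ] ι₁ x ≡ v) ⊎ (∃[ y ] ι₂ y ≡ v)

swap : ∀ {G₁ G₂ G} → Gluing G₁ G₂ G → Gluing G₂ G₁ G
swap g = record
  { ι₁ = ι₂ ; ι₂ = ι₁ ; F₁ = F₂ ; F₂ = F₁
  ; ι₁-injective = ι₂-injective ; ι₂-injective = ι₁-injective
  ; shared₁ = λ y x e → shared₂ x y (sym e) ; shared₂ = λ y x e → shared₁ x y (sym e)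
  ; F₁-shared = λ y f → Product.map₂ sym (F₂-shared y f)
  ; F₂-shared = λ x f → Product.map₂ sym (F₁-shared x f)
  ; F₁-clique = F₂-clique ; F₂-clique = F₁-clique
  ; edge-origin = λ u v a → Sum.swap (edge-origin u v a)
  ; ι₁-edge = ι₂-edge ; ι₂-edge = ι₁-edge
  ; covers = Sum.swap ∘ covers }
  where open Gluing g

-- Walks of G|_W seen from the G₁ side: connectivity among vertices of G₁
-- is the same in G|_W and in G₁|_{ι₁⁻¹ W}, and a walk leaving the image of
-- G₁ has passed through the clique F₁.

module Projection {G₁ G₂ G : Graph} (g : Gluing G₁ G₂ G) (W : Subset (size G)) where
  open Gluing g

  W₁ : Subset (size G₁)
  W₁ = restrict ι₁ W

  module C  = Components G W
  module C₁ = Components G₁ W₁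

  in-image : ∀ {x} → C₁.In x → C.In (ι₁ x)
  in-image {x} e = trans (sym (lookup-restrict ι₁ W x)) e

  in-preimage : ∀ {x v} → ι₁ x ≡ v → C.In v → C₁.In x
  in-preimage {x} refl e = trans (lookup-restrict ι₁ W x) e

  embed-walk : ∀ {a b} → C₁.Walk a b → C.Walk (ι₁ a) (ι₁ b)
  embed-walk C₁.start            = C.start
  embed-walk (C₁.step p wz a wy) = C.step (embed-walk p) (in-image wz) (ι₁-edge _ _ a) (in-image wy)

  embed-connected : ∀ {a b} → C₁.Connected a b → C.Connected (ι₁ a) (ι₁ b)
  embed-connected (wa , wb , p) = in-image wa , in-image wb , embed-walk p

  Projects : Fin (size G₁) → Fin (size G) → Set
  Projects a v = (∀ c → ι₁ c ≡ v → C₁.Connected a c) ×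
                 ((∀ c → ι₁ c ≢ v) → ∃[ s ] lookup F₁ s ≡ true × C₁.Connected a s)

  walk-projection : ∀ {a v} → C₁.In a → C.Walk (ι₁ a) v → Projects a v
  walk-projection {a} wa C.start =
    (λ c e → subst (C₁.Connected a) (ι₁-injective a c (sym e)) (C₁.connected-refl wa)) ,
    (λ off → ⊥-elim (off a refl))
  walk-projection {a} wa (C.step {z} {w} p wz azw ww) with walk-projection wa p | edge-origin z w azw
  ... | at , _ | inj₁ (x , x′ , refl , refl , a₁) =
    (λ c e → subst (C₁.Connected a) (ι₁-injective x′ c (sym e))
               (C₁.connected-trans (at x refl) (C₁.connected-edge (in-preimage refl wz) a₁ (in-preimage refl ww)))) ,
    (λ off → ⊥-elim (off x′ refl))
  ... | at , off-clique | inj₂ (y , y′ , refl , refl , _) = onto-clique , λ _ → at-clique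
    where
    -- the walk has already met F₁: it is now at a shared vertex ι₂ y
    at-clique : ∃[ s ] lookup F₁ s ≡ true × C₁.Connected a s
    at-clique with image? ι₁ (ι₂ y)
    ... | inj₁ (c₀ , e₀) = c₀ , shared₁ c₀ y (sym e₀) , at c₀ e₀
    ... | inj₂ off       = off-clique off
    onto-clique : ∀ c → ι₁ c ≡ ι₂ y′ → C₁.Connected a c
    onto-clique c e with at-clique
    ... | s , fs , cs = C₁.connected-trans cs
          (C₁.clique-connected {F₁} F₁-clique fs (shared₁ c y′ (sym e)) (proj₁ (proj₂ cs)) (in-preimage e ww))

  reflect-connected : ∀ {a b} → C.Connected (ι₁ a) (ι₁ b) → C₁.Connected a b
  reflect-connected {a} {b} (wa , _ , p) = proj₁ (walk-projection (in-preimage refl wa) p) b refl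

  rep-reflects : ∀ {a a′} → C₁.IsRep a → C₁.IsRep a′ → C.rep (ι₁ a) ≡ C.rep (ι₁ a′) → a ≡ a′
  rep-reflects ra ra′ e =
    C₁.rep-unique ra ra′ (reflect-connected (C.same-rep (in-image (proj₁ ra)) (in-image (proj₁ ra′)) e))

-- The components of G|W are those of G₁|W₁ and G₂|W₂, except that the (at
-- most one) component on each side meeting the clique are merged.  We
-- count representatives, exhibiting injections in both directions between
--   Reps(G₁|W₁) ⊎ Reps(G₂|W₂)   and   Reps(G|W) ⊎ {least vertex of F₂ ∩ W₂}.

module ComponentCount {G₁ G₂ G : Graph} (g : Gluing G₁ G₂ G) (W : Subset (size G)) where
  open Gluing g
  module P₁ = Projection g W
  module P₂ = Projection (swap g) W
  module C  = Components G W
  module C₁ = Components G₁ P₁.W₁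
  module C₂ = Components G₂ P₂.W₁

  W₁ : Subset (size G₁)
  W₁ = P₁.W₁

  W₂ : Subset (size G₂)
  W₂ = P₂.W₁

  inClique₂ : Fin (size G₂) → Bool
  inClique₂ s = lookup F₂ s ∧ lookup W₂ s

  touches : Fin (size G₂) → Bool
  touches y = anyFin (λ s → lookup F₂ s ∧ connectedIn G₂ W₂ y s)

  touches-intro : ∀ {y s} → lookup F₂ s ≡ true → C₂.Connected y s → touches y ≡ true
  touches-intro {y} {s} fs c = anyFin⁺ _ s (∧-intro fs (C₂.connected-complete c))

  touches-elim : ∀ {y} → touches y ≡ true → ∃[ s ] lookup F₂ s ≡ true × C₂.Connected y s
  touches-elim {y} e with anyFin⁻ _ e
  ... | s , h with ∧-split (lookup F₂ s) h
  ... | fs , c = s , fs , C₂.connected-sound y s c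

  joined-touches : ∀ {y a} → C₂.In y → C.Connected (ι₂ y) (ι₁ a) → touches y ≡ true
  joined-touches {y} {a} wy (_ , _ , p) with P₂.walk-projection wy p | image? ι₂ (ι₁ a)
  ... | at , _         | inj₁ (d , e) = touches-intro (shared₂ a d e) (at d e)
  ... | _ , off-clique | inj₂ off with off-clique off
  ...   | s , fs , cs = touches-intro fs cs

  touching-unique : ∀ {y y′} → C₂.IsRep y → C₂.IsRep y′ →
    touches y ≡ true → touches y′ ≡ true → y ≡ y′
  touching-unique ry ry′ t t′ with touches-elim t | touches-elim t′
  ... | s , fs , cs | s′ , fs′ , cs′ =
    C₂.rep-unique ry ry′ (C₂.connected-trans cs (C₂.connected-trans clique (C₂.connected-sym cs′)))
    where
    clique : C₂.Connected s s′
    clique = C₂.clique-connected {F₂} F₂-clique fs fs′ (proj₁ (proj₂ cs)) (proj₁ (proj₂ cs′))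

  left : Fin (size G₁) ⊎ Fin (size G₂) → Bool
  left = [ isRep G₁ W₁ , isRep G₂ W₂ ]′

  right : Fin (size G) ⊎ Fin (size G₂) → Bool
  right = [ isRep G W , isLeast inClique₂ ]′

  forward : Fin (size G₁) ⊎ Fin (size G₂) → Fin (size G) ⊎ Fin (size G₂)
  forward (inj₁ x) = inj₁ (C.rep (ι₁ x))
  forward (inj₂ y) = if touches y then inj₂ (fromMaybe y (least inClique₂)) else inj₁ (C.rep (ι₂ y))

  forward-maps : MapsTo left right forward
  forward-maps (inj₁ x) rx = C.rep-isRep (P₁.in-image (proj₁ (C₁.isRep-sound x rx)))
  forward-maps (inj₂ y) ry with touches y in t
  ... | false = C.rep-isRep (P₂.in-image (proj₁ (C₂.isRep-sound y ry)))
  ... | true with touches-elim t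
  ...   | s , fs , cs with least inClique₂ | least-spec inClique₂
  ...     | just u  | found iu below = isLeast-intro inClique₂ u iu below
  ...     | nothing | none never     =
            contradiction (∧-intro fs (proj₁ (proj₂ cs))) λ e → true≢false (trans (sym e) (never s))

  forward-injective : InjectiveOn left forward
  forward-injective (inj₁ a) (inj₁ a′) ra ra′ e =
    cong inj₁ (P₁.rep-reflects (C₁.isRep-sound a ra) (C₁.isRep-sound a′ ra′) (inj₁-injective e))
  forward-injective (inj₁ a) (inj₂ y) ra ry e with touches y in t
  ... | true  = ⊥-elim (inj₁≢inj₂ e)
  ... | false = ⊥-elim (true≢false (trans (sym (joined-touches wy joined)) t))
    where
    wy = proj₁ (C₂.isRep-sound y ry)
    joined : C.Connected (ι₂ y) (ι₁ a)
    joined = C.same-rep (P₂.in-image wy) (P₁.in-image (proj₁ (C₁.isRep-sound a ra))) (sym (inj₁-injective e))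
  forward-injective (inj₂ y) (inj₁ a) ry ra e = sym (forward-injective (inj₁ a) (inj₂ y) ra ry (sym e))
  forward-injective (inj₂ y) (inj₂ y′) ry ry′ e with touches y in t | touches y′ in t′
  ... | true  | true  = cong inj₂ (touching-unique (C₂.isRep-sound y ry) (C₂.isRep-sound y′ ry′) t t′)
  ... | true  | false = ⊥-elim (inj₁≢inj₂ (sym e))
  ... | false | true  = ⊥-elim (inj₁≢inj₂ e)
  ... | false | false = cong inj₂ (P₂.rep-reflects (C₂.isRep-sound y ry) (C₂.isRep-sound y′ ry′) (inj₁-injective e))

  component-in : Fin (size G) → Fin (size G₁) ⊎ Fin (size G₂)
  component-in v = maybe′ inj₁ (maybe′ inj₂ (Sum.map proj₁ proj₁ (covers v))
                              (least λ y → connectedIn G W (ι₂ y) v))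
                            (least λ x → connectedIn G W (ι₁ x) v)

  data ComponentIn (v : Fin (size G)) : Fin (size G₁) ⊎ Fin (size G₂) → Set where
    from₁ : ∀ {x} → C.Connected (ι₁ x) v → C₁.IsRep x → ComponentIn v (inj₁ x)
    from₂ : ∀ {y} → C.Connected (ι₂ y) v → C₂.IsRep y → (∀ x → ¬ C.Connected (ι₁ x) v) →
            ComponentIn v (inj₂ y)

  component-in-spec : ∀ {v} → C.In v → ComponentIn v (component-in v)
  component-in-spec {v} wv
    with least (λ x → connectedIn G W (ι₁ x) v) | least-spec (λ x → connectedIn G W (ι₁ x) v)
  ... | just x | found cx below = from₁ c (P₁.in-preimage refl (proj₁ c) ,
        λ x′ x′<x c′ → C.not-connected (below x′ x′<x) (C.connected-trans (P₁.embed-connected c′) c))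
    where c = C.connected-sound _ _ cx
  ... | nothing | none never₁
    with least (λ y → connectedIn G W (ι₂ y) v) | least-spec (λ y → connectedIn G W (ι₂ y) v)
  ...   | just y | found cy below = from₂ c (P₂.in-preimage refl (proj₁ c) ,
          λ y′ y′<y c′ → C.not-connected (below y′ y′<y) (C.connected-trans (P₂.embed-connected c′) c))
          λ x → C.not-connected (never₁ x)
    where c = C.connected-sound _ _ cy
  ...   | nothing | none never₂ with covers v
  ...     | inj₁ (x , refl) = ⊥-elim (true≢false (trans (sym (C.connected-self wv)) (never₁ x)))
  ...     | inj₂ (y , refl) = ⊥-elim (true≢false (trans (sym (C.connected-self wv)) (never₂ y)))

  component-in-connected : ∀ {v c} → ComponentIn v c → C.Connected ([ ι₁ , ι₂ ]′ c) v
  component-in-connected (from₁ cx _)   = cx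
  component-in-connected (from₂ cy _ _) = cy

  component-in-isRep : ∀ {v c} → ComponentIn v c → left c ≡ true
  component-in-isRep (from₁ _ rx)   = C₁.isRep-complete _ rx
  component-in-isRep (from₂ _ ry _) = C₂.isRep-complete _ ry

  backward : Fin (size G) ⊎ Fin (size G₂) → Fin (size G₁) ⊎ Fin (size G₂)
  backward (inj₁ v) = component-in v
  backward (inj₂ s) = inj₂ (C₂.rep s)

  in-W₂ : ∀ {s} → isLeast inClique₂ s ≡ true → C₂.In s
  in-W₂ {s} e = proj₂ (∧-split (lookup F₂ s) (isLeast-sat inClique₂ s e))

  backward-maps : MapsTo right left backward
  backward-maps (inj₁ v) rv = component-in-isRep (component-in-spec (proj₁ (C.isRep-sound v rv)))
  backward-maps (inj₂ s) rs = C₂.rep-isRep (in-W₂ rs)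

  -- the component of G|W containing a clique vertex s meets the G₁ side, so
  -- it is not sent to the component of s in G₂|W₂
  clique-not-component-in : ∀ v s → right (inj₁ v) ≡ true → right (inj₂ s) ≡ true →
    component-in v ≢ inj₂ (C₂.rep s)
  clique-not-component-in v s rv rs e with component-in v | component-in-spec (proj₁ (C.isRep-sound v rv))
  ... | inj₁ _ | _ = inj₁≢inj₂ e
  ... | inj₂ y | from₂ cy _ apart with F₂-shared s (proj₁ (∧-split (lookup F₂ s) (isLeast-sat inClique₂ s rs)))
  ...   | x , ιs≡ιx = apart x (C.connected-trans shared (C.connected-trans to-rep cy))
    where
    ws = in-W₂ rs
    shared : C.Connected (ι₁ x) (ι₂ s)
    shared = subst (λ u → C.Connected u (ι₂ s)) ιs≡ιx (C.connected-refl (P₂.in-image ws))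
    to-rep : C.Connected (ι₂ s) (ι₂ y)
    to-rep = P₂.embed-connected (C₂.connected-sym
               (subst (λ r → C₂.Connected r s) (sym (inj₂-injective e)) (proj₂ (C₂.rep-spec ws))))

  backward-injective : InjectiveOn right backward
  backward-injective (inj₁ v) (inj₁ v′) rv rv′ e =
    cong inj₁ (C.rep-unique (C.isRep-sound v rv) (C.isRep-sound v′ rv′) (C.connected-trans (C.connected-sym (in-v wv)) in-v′))
    where
    wv  = proj₁ (C.isRep-sound v rv)
    wv′ = proj₁ (C.isRep-sound v′ rv′)
    in-v : ∀ {u} (wu : C.In u) → C.Connected ([ ι₁ , ι₂ ]′ (component-in u)) u
    in-v wu = component-in-connected (component-in-spec wu)
    in-v′ : C.Connected ([ ι₁ , ι₂ ]′ (component-in v)) v′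
    in-v′ = subst (λ c → C.Connected ([ ι₁ , ι₂ ]′ c) v′) (sym e) (in-v wv′)
  backward-injective (inj₁ v) (inj₂ s) rv rs e = ⊥-elim (clique-not-component-in v s rv rs e)
  backward-injective (inj₂ s) (inj₁ v) rs rv e = ⊥-elim (clique-not-component-in v s rv rs (sym e))
  backward-injective (inj₂ s) (inj₂ s′) rs rs′ e = cong inj₂ (isLeast-unique inClique₂ s s′ rs rs′)

  component-count : nc G₁ W₁ + nc G₂ W₂ ≡ nc G W + bit (anyFin inClique₂)
  component-count = begin
    nc G₁ W₁ + nc G₂ W₂                          ≡⟨ cong₂ _+_ C₁.nc-count C₂.nc-count ⟩
    count⊎ left                                  ≡⟨ count⊎-≡ left right forward backward
                                                      forward-maps forward-injective backward-maps backward-injective ⟩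
    count⊎ right                                 ≡⟨ cong₂ _+_ (sym C.nc-count) (count-isLeast inClique₂) ⟩
    nc G W + bit (anyFin inClique₂)              ∎
    where open ≡-Reasoning

-- Integer sequences, read as coefficient sequences of polynomials in x.

Seq : Set
Seq = ℕ → ℤ

infixl 6 _⊕_
_⊕_ : ∀ {A : Set} → (A → ℤ) → (A → ℤ) → A → ℤ
(f ⊕ g) a = f a +ℤ g a

-- multiplication by x
shift : Seq → Seq
shift a zero    = + 0
shift a (suc k) = a k

-- multiplication by (1 + x)^d
binomial : ℕ → Seq → Seq
binomial zero    a = a
binomial (suc d) a = binomial d a ⊕ shift (binomial d a)

shift-cong : ∀ {a c} → a ≗ c → shift a ≗ shift c
shift-cong a≗c zero    = refl
shift-cong a≗c (suc k) = a≗c k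

shift-⊕ : ∀ a c → shift (a ⊕ c) ≗ shift a ⊕ shift c
shift-⊕ a c zero    = refl
shift-⊕ a c (suc k) = refl

binomial-cong : ∀ d {a c} → a ≗ c → binomial d a ≗ binomial d c
binomial-cong zero    a≗c = a≗c
binomial-cong (suc d) a≗c k =
  cong₂ _+ℤ_ (binomial-cong d a≗c k) (shift-cong (binomial-cong d a≗c) k)

binomial-⊕ : ∀ d a c → binomial d (a ⊕ c) ≗ binomial d a ⊕ binomial d c
binomial-⊕ zero    a c k = refl
binomial-⊕ (suc d) a c k = begin
  binomial d (a ⊕ c) k +ℤ shift (binomial d (a ⊕ c)) k
    ≡⟨ cong₂ _+ℤ_ (binomial-⊕ d a c k) (shift-cong (binomial-⊕ d a c) k) ⟩
  (binomial d a k +ℤ binomial d c k) +ℤ shift (binomial d a ⊕ binomial d c) k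
    ≡⟨ cong (λ z → (binomial d a k +ℤ binomial d c k) +ℤ z) (shift-⊕ (binomial d a) (binomial d c) k) ⟩
  (binomial d a k +ℤ binomial d c k) +ℤ (shift (binomial d a) k +ℤ shift (binomial d c) k)
    ≡⟨ interchange (binomial d a k) (binomial d c k) (shift (binomial d a) k) (shift (binomial d c) k) ⟩
  binomial (suc d) a k +ℤ binomial (suc d) c k ∎
  where open ≡-Reasoning

binomial-shift : ∀ d a → binomial d (shift a) ≗ shift (binomial d a)
binomial-shift zero    a k = refl
binomial-shift (suc d) a k = begin
  binomial d (shift a) k +ℤ shift (binomial d (shift a)) k
    ≡⟨ cong₂ _+ℤ_ (binomial-shift d a k) (shift-cong (binomial-shift d a) k) ⟩
  shift (binomial d a) k +ℤ shift (shift (binomial d a)) k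
    ≡⟨ shift-⊕ (binomial d a) (shift (binomial d a)) k ⟨
  shift (binomial (suc d) a) k ∎
  where open ≡-Reasoning

-- Graded subset sums: gsum n f k = Σ_{W ⊆ Fin n, |W| = k} f W, computed by
-- splitting on whether the first element is in W.

gsum : (n : ℕ) → (Subset n → ℤ) → Seq
gsum zero    f zero    = f []
gsum zero    f (suc k) = + 0
gsum (suc n) f k       = (gsum n (f ∘ (outside ∷_)) ⊕ shift (gsum n (f ∘ (inside ∷_)))) k

gsum-cong : ∀ n {f g : Subset n → ℤ} → f ≗ g → gsum n f ≗ gsum n g
gsum-cong zero    f≗g zero    = f≗g []
gsum-cong zero    f≗g (suc k) = refl
gsum-cong (suc n) f≗g k =
  cong₂ _+ℤ_ (gsum-cong n (f≗g ∘ (outside ∷_)) k) (shift-cong (gsum-cong n (f≗g ∘ (inside ∷_))) k)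

gsum-⊕ : ∀ n (f g : Subset n → ℤ) → gsum n (f ⊕ g) ≗ gsum n f ⊕ gsum n g
gsum-⊕ zero    f g zero    = refl
gsum-⊕ zero    f g (suc k) = refl
gsum-⊕ (suc n) f g k = begin
  gsum n ((f ⊕ g) ∘ (outside ∷_)) k +ℤ shift (gsum n ((f ⊕ g) ∘ (inside ∷_))) k
    ≡⟨ cong₂ _+ℤ_ (gsum-⊕ n f₀ g₀ k) (shift-cong (gsum-⊕ n f₁ g₁) k) ⟩
  (gsum n f₀ k +ℤ gsum n g₀ k) +ℤ shift (gsum n f₁ ⊕ gsum n g₁) k
    ≡⟨ cong (λ z → (gsum n f₀ k +ℤ gsum n g₀ k) +ℤ z) (shift-⊕ (gsum n f₁) (gsum n g₁) k) ⟩
  (gsum n f₀ k +ℤ gsum n g₀ k) +ℤ (shift (gsum n f₁) k +ℤ shift (gsum n g₁) k)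
    ≡⟨ interchange (gsum n f₀ k) (gsum n g₀ k) (shift (gsum n f₁) k) (shift (gsum n g₁) k) ⟩
  gsum (suc n) f k +ℤ gsum (suc n) g k ∎
  where
  open ≡-Reasoning
  f₀ = f ∘ (outside ∷_)
  g₀ = g ∘ (outside ∷_)
  f₁ = f ∘ (inside ∷_)
  g₁ = g ∘ (inside ∷_)

gsum-insertAt : ∀ m (i : Fin (suc m)) (φ : Subset (suc m) → ℤ) →
  gsum (suc m) φ ≗ gsum m (λ U → φ (insertAt U i outside)) ⊕ shift (gsum m (λ U → φ (insertAt U i inside)))
gsum-insertAt m       zero    φ k = refl
gsum-insertAt (suc m) (suc i) φ k = begin
  gsum (suc m) (φ ∘ (outside ∷_)) k +ℤ shift (gsum (suc m) (φ ∘ (inside ∷_))) k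
    ≡⟨ cong₂ _+ℤ_ (gsum-insertAt m i (φ ∘ (outside ∷_)) k)
                  (shift-cong (gsum-insertAt m i (φ ∘ (inside ∷_))) k) ⟩
  (gsum m φ₀₀ k +ℤ shift (gsum m φ₀₁) k) +ℤ shift (gsum m φ₁₀ ⊕ shift (gsum m φ₁₁)) k
    ≡⟨ cong (λ z → (gsum m φ₀₀ k +ℤ shift (gsum m φ₀₁) k) +ℤ z)
            (shift-⊕ (gsum m φ₁₀) (shift (gsum m φ₁₁)) k) ⟩
  (gsum m φ₀₀ k +ℤ shift (gsum m φ₀₁) k) +ℤ (shift (gsum m φ₁₀) k +ℤ shift (shift (gsum m φ₁₁)) k)
    ≡⟨ interchange (gsum m φ₀₀ k) (shift (gsum m φ₀₁) k)
                   (shift (gsum m φ₁₀) k) (shift (shift (gsum m φ₁₁)) k) ⟩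
  (gsum m φ₀₀ k +ℤ shift (gsum m φ₁₀) k) +ℤ (shift (gsum m φ₀₁) k +ℤ shift (shift (gsum m φ₁₁)) k)
    ≡⟨ cong (λ z → (gsum m φ₀₀ k +ℤ shift (gsum m φ₁₀) k) +ℤ z)
            (shift-⊕ (gsum m φ₀₁) (shift (gsum m φ₁₁)) k) ⟨
  (gsum m φ₀₀ k +ℤ shift (gsum m φ₁₀) k) +ℤ shift (gsum m φ₀₁ ⊕ shift (gsum m φ₁₁)) k ∎
  where
  open ≡-Reasoning
  φ₀₀ φ₀₁ φ₁₀ φ₁₁ : Subset m → ℤ
  φ₀₀ U = φ (outside ∷ insertAt U i outside)
  φ₀₁ U = φ (outside ∷ insertAt U i inside)
  φ₁₀ U = φ (inside ∷ insertAt U i outside)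
  φ₁₁ U = φ (inside ∷ insertAt U i inside)

IsInjective : ∀ {m n} → (Fin m → Fin n) → Set
IsInjective ι = ∀ x y → ι x ≡ ι y → x ≡ y

module MissesZero {m n} (ι : Fin m → Fin (suc n)) (off : ∀ c → ι c ≢ zero) where

  ι′ : Fin m → Fin n
  ι′ c = punchOut {i = zero} (off c ∘ sym)

  suc-ι′ : ∀ c → suc (ι′ c) ≡ ι c
  suc-ι′ c = punchIn-punchOut (off c ∘ sym)

  ι′-injective : IsInjective ι → IsInjective ι′
  ι′-injective inj x y e = inj x y (trans (sym (suc-ι′ x)) (trans (cong suc e) (suc-ι′ y)))

  restrict-∷ : ∀ v W → restrict ι (v ∷ W) ≡ restrict ι′ W
  restrict-∷ v W = tabulate-cong λ c → cong (lookup (v ∷ W)) (sym (suc-ι′ c))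

module HitsZero {m n} (ι : Fin (suc m) → Fin (suc n)) (inj : IsInjective ι)
                (i : Fin (suc m)) (hit : ι i ≡ zero) where

  off : ∀ j → zero ≢ ι (punchIn i j)
  off j e = punchInᵢ≢i i j (inj _ _ (trans (sym e) (sym hit)))

  ι″ : Fin m → Fin n
  ι″ j = punchOut (off j)

  suc-ι″ : ∀ j → suc (ι″ j) ≡ ι (punchIn i j)
  suc-ι″ j = punchIn-punchOut (off j)

  ι″-injective : IsInjective ι″
  ι″-injective x y e = punchIn-injective i x y
    (inj _ _ (trans (sym (suc-ι″ x)) (trans (cong suc e) (suc-ι″ y))))

  restrict-∷ : ∀ v W → restrict ι (v ∷ W) ≡ insertAt (restrict ι″ W) i v
  restrict-∷ v W = trans (tabulate-cong pointwise) (tabulate∘lookup (insertAt (restrict ι″ W) i v))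
    where
    pointwise : ∀ c → lookup (v ∷ W) (ι c) ≡ lookup (insertAt (restrict ι″ W) i v) c
    pointwise c with c Fin.≟ i
    ... | yes refl = trans (cong (lookup (v ∷ W)) hit) (sym (insertAt-lookup (restrict ι″ W) i v))
    ... | no  c≢i  = begin
      lookup (v ∷ W) (ι c)                              ≡⟨ cong (lookup (v ∷ W) ∘ ι) (sym c≡) ⟩
      lookup (v ∷ W) (ι (punchIn i j))                  ≡⟨ cong (lookup (v ∷ W)) (sym (suc-ι″ j)) ⟩
      lookup W (ι″ j)                                   ≡⟨ lookup-restrict ι″ W j ⟨
      lookup (restrict ι″ W) j                          ≡⟨ insertAt-punchIn (restrict ι″ W) i v j ⟨
      lookup (insertAt (restrict ι″ W) i v) (punchIn i j) ≡⟨ cong (lookup (insertAt (restrict ι″ W) i v)) c≡ ⟩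
      lookup (insertAt (restrict ι″ W) i v) c           ∎
      where
      open ≡-Reasoning
      j : Fin m
      j = punchOut (c≢i ∘ sym)
      c≡ : punchIn i j ≡ c
      c≡ = punchIn-punchOut (c≢i ∘ sym)

-- Summing a function of ι⁻¹(W) over the W ⊆ Fin n of size k: every U ⊆ Fin m
-- arises from the sets ι(U) ∪ R with R outside the image of ι, so the sum is
-- Σ_j C(n - m, k - j) Σ_{|U| = j} φ U.
gsum-restrict : ∀ {m n} (ι : Fin m → Fin n) → IsInjective ι → (φ : Subset m → ℤ) →
  gsum n (φ ∘ restrict ι) ≗ binomial (n ∸ m) (gsum m φ)
gsum-restrict {zero}  {zero}  ι inj φ zero    = refl
gsum-restrict {zero}  {zero}  ι inj φ (suc k) = refl
gsum-restrict {suc m} {zero}  ι inj φ k with ι zero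
... | ()
gsum-restrict {m} {suc n} ι inj φ k with image? ι zero
... | inj₂ off = begin
  gsum n (λ W → φ (restrict ι (outside ∷ W))) k +ℤ shift (gsum n (λ W → φ (restrict ι (inside ∷ W)))) k
    ≡⟨ cong₂ _+ℤ_ (gsum-cong n (cong φ ∘ restrict-∷ outside) k)
                 (shift-cong (gsum-cong n (cong φ ∘ restrict-∷ inside)) k) ⟩
  gsum n (φ ∘ restrict ι′) k +ℤ shift (gsum n (φ ∘ restrict ι′)) k
    ≡⟨ cong₂ _+ℤ_ (gsum-restrict ι′ (ι′-injective inj) φ k)
                 (shift-cong (gsum-restrict ι′ (ι′-injective inj) φ) k) ⟩
  binomial (suc (n ∸ m)) (gsum m φ) k
    ≡⟨ cong (λ d → binomial d (gsum m φ) k) (sym (+-∸-assoc 1 m≤n)) ⟩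
  binomial (suc n ∸ m) (gsum m φ) k ∎
  where
  open ≡-Reasoning
  open MissesZero ι off
  m≤n : m ≤ n
  m≤n = injective⇒≤ {f = ι′} (ι′-injective inj _ _)
gsum-restrict {zero}  {suc n} ι inj φ k | inj₁ (() , _)
gsum-restrict {suc m} {suc n} ι inj φ k | inj₁ (i , hit) = begin
  gsum n (λ W → φ (restrict ι (outside ∷ W))) k +ℤ shift (gsum n (λ W → φ (restrict ι (inside ∷ W)))) k
    ≡⟨ cong₂ _+ℤ_ (gsum-cong n (cong φ ∘ restrict-∷ outside) k)
                 (shift-cong (gsum-cong n (cong φ ∘ restrict-∷ inside)) k) ⟩
  gsum n (φ₀ ∘ restrict ι″) k +ℤ shift (gsum n (φ₁ ∘ restrict ι″)) k
    ≡⟨ cong₂ _+ℤ_ (gsum-restrict ι″ ι″-injective φ₀ k) (shift-cong (gsum-restrict ι″ ι″-injective φ₁) k) ⟩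
  binomial (n ∸ m) (gsum m φ₀) k +ℤ shift (binomial (n ∸ m) (gsum m φ₁)) k
    ≡⟨ cong (λ z → binomial (n ∸ m) (gsum m φ₀) k +ℤ z) (binomial-shift (n ∸ m) (gsum m φ₁) k) ⟨
  binomial (n ∸ m) (gsum m φ₀) k +ℤ binomial (n ∸ m) (shift (gsum m φ₁)) k
    ≡⟨ binomial-⊕ (n ∸ m) (gsum m φ₀) (shift (gsum m φ₁)) k ⟨
  binomial (n ∸ m) (gsum m φ₀ ⊕ shift (gsum m φ₁)) k
    ≡⟨ binomial-cong (n ∸ m) (gsum-insertAt m i φ) k ⟨
  binomial (n ∸ m) (gsum (suc m) φ) k ∎
  where
  open ≡-Reasoning
  open HitsZero ι inj i hit
  φ₀ φ₁ : Subset m → ℤ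
  φ₀ U = φ (insertAt U i outside)
  φ₁ U = φ (insertAt U i inside)

sumℤ-++ : ∀ xs ys → sumℤ (xs ++ ys) ≡ sumℤ xs +ℤ sumℤ ys
sumℤ-++ []       ys = sym (ℤ.+-identityˡ (sumℤ ys))
sumℤ-++ (x ∷ xs) ys = trans (cong (λ z → x +ℤ z) (sumℤ-++ xs ys)) (sym (ℤ.+-assoc x (sumℤ xs) (sumℤ ys)))

filter-map : ∀ {A B : Set} {P : Pred B 0ℓ} {Q : Pred A 0ℓ} (P? : Decidable P) (Q? : Decidable Q)
  (g : A → B) → (∀ x → does (P? (g x)) ≡ does (Q? x)) → ∀ xs → filter P? (map g xs) ≡ map g (filter Q? xs)
filter-map P? Q? g same []       = refl
filter-map P? Q? g same (x ∷ xs) with does (P? (g x)) | does (Q? x) | same x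
... | true  | true  | refl = cong (g x ∷_) (filter-map P? Q? g same xs)
... | false | false | refl = filter-map P? Q? g same xs

sum-allSubsets : ∀ n k (f : Subset n → ℤ) →
  sumℤ (map f (filter (λ W → ∣ W ∣ ℕ.≟ k) (allSubsets n))) ≡ gsum n f k
sum-allSubsets zero zero    f = ℤ.+-identityʳ (f [])
sum-allSubsets zero (suc k) f = refl
sum-allSubsets (suc n) k f = begin
  sumℤ (map f (filter P? (map (outside ∷_) A ++ map (inside ∷_) A)))
    ≡⟨ cong (sumℤ ∘ map f) (filter-++ P? (map (outside ∷_) A) (map (inside ∷_) A)) ⟩
  sumℤ (map f (filter P? (map (outside ∷_) A) ++ filter P? (map (inside ∷_) A)))
    ≡⟨ cong sumℤ (map-++ f (filter P? (map (outside ∷_) A)) (filter P? (map (inside ∷_) A))) ⟩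
  sumℤ (map f (filter P? (map (outside ∷_) A)) ++ map f (filter P? (map (inside ∷_) A)))
    ≡⟨ sumℤ-++ (map f (filter P? (map (outside ∷_) A))) (map f (filter P? (map (inside ∷_) A))) ⟩
  sumℤ (map f (filter P? (map (outside ∷_) A))) +ℤ sumℤ (map f (filter P? (map (inside ∷_) A)))
    ≡⟨ cong₂ _+ℤ_ without-first (with-first k) ⟩
  gsum (suc n) f k ∎
  where
  open ≡-Reasoning
  A = allSubsets n
  P? : Decidable (λ (W : Subset (suc n)) → ∣ W ∣ ≡ k)
  P? W = ∣ W ∣ ℕ.≟ k
  without-first : sumℤ (map f (filter P? (map (outside ∷_) A))) ≡ gsum n (f ∘ (outside ∷_)) k
  without-first = begin
    sumℤ (map f (filter P? (map (outside ∷_) A)))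
      ≡⟨ cong (sumℤ ∘ map f) (filter-map P? (λ W → ∣ W ∣ ℕ.≟ k) (outside ∷_) (λ _ → refl) A) ⟩
    sumℤ (map f (map (outside ∷_) (filter (λ W → ∣ W ∣ ℕ.≟ k) A)))
      ≡⟨ cong sumℤ (map-∘ (filter (λ W → ∣ W ∣ ℕ.≟ k) A)) ⟨
    sumℤ (map (f ∘ (outside ∷_)) (filter (λ W → ∣ W ∣ ℕ.≟ k) A))
      ≡⟨ sum-allSubsets n k (f ∘ (outside ∷_)) ⟩
    gsum n (f ∘ (outside ∷_)) k ∎
  with-first : ∀ k → sumℤ (map f (filter (λ (W : Subset (suc n)) → ∣ W ∣ ℕ.≟ k) (map (inside ∷_) A))) ≡
                     shift (gsum n (f ∘ (inside ∷_))) k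
  with-first zero = begin
    sumℤ (map f (filter (λ W → ∣ W ∣ ℕ.≟ 0) (map (inside ∷_) A)))
      ≡⟨ cong (sumℤ ∘ map f) (filter-map (λ W → ∣ W ∣ ℕ.≟ 0) (λ W → suc ∣ W ∣ ℕ.≟ 0) (inside ∷_) (λ _ → refl) A) ⟩
    sumℤ (map f (map (inside ∷_) (filter (λ W → suc ∣ W ∣ ℕ.≟ 0) A)))
      ≡⟨ cong (sumℤ ∘ map f ∘ map (inside ∷_)) (filter-none (λ W → suc ∣ W ∣ ℕ.≟ 0) (All.universal (λ _ ()) A)) ⟩
    + 0 ∎
  with-first (suc k) = begin
    sumℤ (map f (filter (λ W → ∣ W ∣ ℕ.≟ suc k) (map (inside ∷_) A)))
      ≡⟨ cong (sumℤ ∘ map f) (filter-map (λ W → ∣ W ∣ ℕ.≟ suc k) (λ W → ∣ W ∣ ℕ.≟ k) (inside ∷_) (λ _ → refl) A) ⟩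
    sumℤ (map f (map (inside ∷_) (filter (λ W → ∣ W ∣ ℕ.≟ k) A)))
      ≡⟨ cong sumℤ (map-∘ (filter (λ W → ∣ W ∣ ℕ.≟ k) A)) ⟨
    sumℤ (map (f ∘ (inside ∷_)) (filter (λ W → ∣ W ∣ ℕ.≟ k) A))
      ≡⟨ sum-allSubsets n k (f ∘ (inside ∷_)) ⟩
    gsum n (f ∘ (inside ∷_)) k ∎

b-gsum : ∀ k G → b k G ≡ gsum (size G) (λ W → + nc G W - + 1) k
b-gsum k G = sum-allSubsets (size G) k (λ W → + nc G W - + 1)

gluing : ∀ {t G₁ G₂ G} → IsConnSum t G₁ G₂ G → Gluing G₁ G₂ G
gluing cs = record
  { ι₁ = ι₁ ; ι₂ = ι₂ ; F₁ = F₁ ; F₂ = F₂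
  ; ι₁-injective = ι₁-inj ; ι₂-injective = ι₂-inj
  ; shared₁ = shared₁
  ; shared₂ = λ x y e → from (overlap₂ y) (x , shared₁ x y e , sym e)
  ; F₁-shared = λ x f → to (overlap₁ x) f
  ; F₂-shared = λ y f → let (x , _ , e) = to (overlap₂ y) f in x , sym e
  ; F₁-clique = F₁-clique ; F₂-clique = F₂-clique
  ; edge-origin = λ u v a → to (edges u v) a
  ; ι₁-edge = λ x x′ a → from (edges (ι₁ x) (ι₁ x′)) (inj₁ (x , x′ , refl , refl , a))
  ; ι₂-edge = λ y y′ a → from (edges (ι₂ y) (ι₂ y′)) (inj₂ (y , y′ , refl , refl , a))
  ; covers = covers }
  where
  open IsConnSum cs
  shared₁ : ∀ x y → ι₂ y ≡ ι₁ x → lookup F₁ x ≡ true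
  shared₁ x y e = from (overlap₁ x) (y , e)

enum : ∀ {n} (F : Subset n) → Fin ∣ F ∣ → Fin n
enum (true  ∷ F) zero    = zero
enum (true  ∷ F) (suc j) = suc (enum F j)
enum (false ∷ F) j       = suc (enum F j)

enum-injective : ∀ {n} (F : Subset n) → IsInjective (enum F)
enum-injective (true  ∷ F) zero    zero    e = refl
enum-injective (true  ∷ F) (suc x) (suc y) e = cong suc (enum-injective F x y (suc-injective e))
enum-injective (false ∷ F) x       y       e = enum-injective F x y (suc-injective e)

any-enum : ∀ {n} (F : Subset n) (p : Fin n → Bool) →
  anyFin (λ s → lookup F s ∧ p s) ≡ anyFin (p ∘ enum F)
any-enum []          p = refl
any-enum (true  ∷ F) p = cong (p zero ∨_) (any-enum F (p ∘ suc))
any-enum (false ∷ F) p = any-enum F (p ∘ suc)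

count-outside : ∀ {n} (F : Subset n) → count (not ∘ lookup F) + ∣ F ∣ ≡ n
count-outside []          = refl
count-outside (true  ∷ F) = trans (+-suc _ ∣ F ∣) (cong suc (count-outside F))
count-outside (false ∷ F) = cong suc (count-outside F)

-- Vertex count of a gluing: V ≅ V₁ ⊎ (V₂ ∖ F₂), so |V| + |F₂| = |V₁| + |V₂|.
module VertexCount {G₁ G₂ G : Graph} (g : Gluing G₁ G₂ G) where
  open Gluing g

  everything : Fin (size G) ⊎ Fin 0 → Bool
  everything _ = true

  pieces : Fin (size G₁) ⊎ Fin (size G₂) → Bool
  pieces = [ (λ _ → true) , not ∘ lookup F₂ ]′

  origin : ∀ v → (∃[ x ] ι₁ x ≡ v) ⊎ (∃[ y ] ι₂ y ≡ v × (∀ x → ι₁ x ≢ v))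
  origin v with image? ι₁ v | covers v
  ... | inj₁ hit | _            = inj₁ hit
  ... | inj₂ off | inj₁ (x , e) = ⊥-elim (off x e)
  ... | inj₂ off | inj₂ (y , e) = inj₂ (y , e , off)

  embed : Fin (size G₁) ⊎ Fin (size G₂) → Fin (size G) ⊎ Fin 0
  embed = inj₁ ∘ [ ι₁ , ι₂ ]′

  preimage : Fin (size G) ⊎ Fin 0 → Fin (size G₁) ⊎ Fin (size G₂)
  preimage (inj₁ v) = Sum.map proj₁ proj₁ (origin v)

  embed-preimage : ∀ v → embed (preimage (inj₁ v)) ≡ inj₁ v
  embed-preimage v with origin v
  ... | inj₁ (x , e)     = cong inj₁ e
  ... | inj₂ (y , e , _) = cong inj₁ e

  preimage-maps : MapsTo everything pieces preimage
  preimage-maps (inj₁ v) _ with origin v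
  ... | inj₁ _ = refl
  ... | inj₂ (y , e , off) with lookup F₂ y in f
  ...   | false = refl
  ...   | true with F₂-shared y f
  ...     | x , ιy≡ιx = ⊥-elim (off x (trans (sym ιy≡ιx) e))

  preimage-injective : InjectiveOn everything preimage
  preimage-injective (inj₁ v) (inj₁ v′) _ _ e =
    trans (sym (embed-preimage v)) (trans (cong embed e) (embed-preimage v′))

  embed-injective : InjectiveOn pieces embed
  embed-injective (inj₁ x) (inj₁ x′) _ _ e = cong inj₁ (ι₁-injective x x′ (inj₁-injective e))
  embed-injective (inj₂ y) (inj₂ y′) _ _ e = cong inj₂ (ι₂-injective y y′ (inj₁-injective e))
  embed-injective (inj₁ x) (inj₂ y)  _ ny e = ⊥-elim (not-shared y ny (shared₂ x y (sym (inj₁-injective e))))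
    where
    not-shared : ∀ y → not (lookup F₂ y) ≡ true → lookup F₂ y ≢ true
    not-shared y ny f rewrite f = true≢false (sym ny)
  embed-injective (inj₂ y) (inj₁ x) ny _ e = sym (embed-injective (inj₁ x) (inj₂ y) refl ny (sym e))

  vertex-count : size G + ∣ F₂ ∣ ≡ size G₁ + size G₂
  vertex-count = begin
    size G + ∣ F₂ ∣                                   ≡⟨ cong (_+ ∣ F₂ ∣) vertices ⟩
    (size G₁ + count (not ∘ lookup F₂)) + ∣ F₂ ∣       ≡⟨ +-assoc (size G₁) _ ∣ F₂ ∣ ⟩
    size G₁ + (count (not ∘ lookup F₂) + ∣ F₂ ∣)       ≡⟨ cong (λ z → size G₁ + z) (count-outside F₂) ⟩
    size G₁ + size G₂                                 ∎
    where
    open ≡-Reasoning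
    vertices : size G ≡ size G₁ + count (not ∘ lookup F₂)
    vertices = begin
      size G                                     ≡⟨ trans (sym (count-true (size G))) (sym (+-identityʳ _)) ⟩
      count⊎ everything                          ≡⟨ count⊎-≡ everything pieces preimage embed
                                                      preimage-maps preimage-injective (λ _ _ → refl) embed-injective ⟩
      count⊎ pieces                              ≡⟨ cong (_+ count (not ∘ lookup F₂)) (count-true (size G₁)) ⟩
      size G₁ + count (not ∘ lookup F₂)          ∎

-- 1 if U is empty and 0 otherwise: the correction for the merged component
emptyWeight : ∀ {m} → Subset m → ℤ
emptyWeight U = + 1 - + bit (anyFin (lookup U))

reduced-sum : ∀ a c d e → a + c ≡ d + e → + d - + 1 ≡ ((+ a - + 1) +ℤ (+ c - + 1)) +ℤ (+ 1 - + e)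
reduced-sum a c d e h = begin
  + d - + 1                                  ≡⟨ cancel-e (+ d) (+ e) ⟩
  ((+ d +ℤ + e) - + e) - + 1                 ≡⟨ cong (λ z → (z - + e) - + 1) h′ ⟨
  ((+ a +ℤ + c) - + e) - + 1                 ≡⟨ regroup (+ a) (+ c) (+ e) ⟩
  ((+ a - + 1) +ℤ (+ c - + 1)) +ℤ (+ 1 - + e) ∎
  where
  open ≡-Reasoning
  cancel-e : ∀ x y → x - + 1 ≡ ((x +ℤ y) - y) - + 1
  cancel-e = solve-∀
  regroup : ∀ x z y → ((x +ℤ z) - y) - + 1 ≡ ((x - + 1) +ℤ (z - + 1)) +ℤ (+ 1 - y)
  regroup = solve-∀
  h′ : + a +ℤ + c ≡ + d +ℤ + e
  h′ = trans (sym (ℤ.pos-+ a c)) (trans (cong +_ h) (ℤ.pos-+ d e))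

module ConnectedSum {t G₁ G₂ G} (cs : IsConnSum t G₁ G₂ G) where
  g : Gluing G₁ G₂ G
  g = gluing cs
  open Gluing g

  κ : Fin ∣ F₂ ∣ → Fin (size G)
  κ = ι₂ ∘ enum F₂

  nc-decomposition : ∀ W → + nc G W - + 1 ≡
    ((+ nc G₁ (restrict ι₁ W) - + 1) +ℤ (+ nc G₂ (restrict ι₂ W) - + 1)) +ℤ emptyWeight (restrict κ W)
  nc-decomposition W =
    trans (reduced-sum (nc G₁ W₁) (nc G₂ W₂) (nc G W) _ component-count)
          (cong (λ e → ((+ nc G₁ W₁ - + 1) +ℤ (+ nc G₂ W₂ - + 1)) +ℤ (+ 1 - + bit e)) meets)
    where
    open ComponentCount g W
    meets : anyFin inClique₂ ≡ anyFin (lookup (restrict κ W))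
    meets = trans (any-enum F₂ (lookup W₂)) (anyFin-cong λ j →
              trans (lookup-restrict ι₂ W (enum F₂ j)) (sym (lookup-restrict κ W j)))

  b-decomposition : ∀ k → b k G ≡
    (binomial (size G ∸ size G₁) (λ j → b j G₁) k +ℤ binomial (size G ∸ size G₂) (λ j → b j G₂) k)
      +ℤ binomial (size G ∸ t) (gsum t emptyWeight) k
  b-decomposition k = begin
    b k G
      ≡⟨ b-gsum k G ⟩
    gsum n (λ W → + nc G W - + 1) k
      ≡⟨ gsum-cong n nc-decomposition k ⟩
    gsum n ((A₁ ∘ restrict ι₁ ⊕ A₂ ∘ restrict ι₂) ⊕ emptyWeight ∘ restrict κ) k
      ≡⟨ gsum-⊕ n (A₁ ∘ restrict ι₁ ⊕ A₂ ∘ restrict ι₂) (emptyWeight ∘ restrict κ) k ⟩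
    gsum n (A₁ ∘ restrict ι₁ ⊕ A₂ ∘ restrict ι₂) k +ℤ gsum n (emptyWeight ∘ restrict κ) k
      ≡⟨ cong (_+ℤ gsum n (emptyWeight ∘ restrict κ) k) (gsum-⊕ n (A₁ ∘ restrict ι₁) (A₂ ∘ restrict ι₂) k) ⟩
    (gsum n (A₁ ∘ restrict ι₁) k +ℤ gsum n (A₂ ∘ restrict ι₂) k) +ℤ gsum n (emptyWeight ∘ restrict κ) k
      ≡⟨ cong₂ _+ℤ_ (cong₂ _+ℤ_ (gsum-restrict ι₁ ι₁-injective A₁ k) (gsum-restrict ι₂ ι₂-injective A₂ k))
                    (gsum-restrict κ κ-injective emptyWeight k) ⟩
    (binomial (n ∸ size G₁) (gsum (size G₁) A₁) k +ℤ binomial (n ∸ size G₂) (gsum (size G₂) A₂) k)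
      +ℤ binomial (n ∸ ∣ F₂ ∣) (gsum ∣ F₂ ∣ emptyWeight) k
      ≡⟨ cong₂ _+ℤ_ (cong₂ _+ℤ_ (binomial-cong (n ∸ size G₁) (λ j → sym (b-gsum j G₁)) k)
                                (binomial-cong (n ∸ size G₂) (λ j → sym (b-gsum j G₂)) k))
                    (cong (λ m → binomial (n ∸ m) (gsum m emptyWeight) k) (IsConnSum.|F₂|≡t cs)) ⟩
    (binomial (n ∸ size G₁) (λ j → b j G₁) k +ℤ binomial (n ∸ size G₂) (λ j → b j G₂) k)
      +ℤ binomial (n ∸ t) (gsum t emptyWeight) k ∎
    where
    open ≡-Reasoning
    n = size G
    A₁ : Subset (size G₁) → ℤ
    A₁ U = + nc G₁ U - + 1
    A₂ : Subset (size G₂) → ℤ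
    A₂ U = + nc G₂ U - + 1
    κ-injective : IsInjective κ
    κ-injective x y e = enum-injective F₂ x y (ι₂-injective _ _ e)

  vertex-count : size G + t ≡ size G₁ + size G₂
  vertex-count = subst (λ m → size G + m ≡ size G₁ + size G₂) (IsConnSum.|F₂|≡t cs) (VertexCount.vertex-count g)

-- The profile of a graph: the data (|V|, b_•) that a connected sum
-- propagates.  Profiles are compared pointwise.

record Profile : Set where
  constructor profile
  field
    vertices : ℕ
    bseq    : Seq
open Profile

profileOf : Graph → Profile
profileOf G = profile (size G) (λ k → b k G)

_≈_ : Profile → Profile → Set
P ≈ Q = vertices P ≡ vertices Q × bseq P ≗ bseq Q

glue-b : (t n n₁ n₂ : ℕ) → Seq → Seq → Seq
glue-b t n n₁ n₂ β₁ β₂ =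
  binomial (n ∸ n₁) β₁ ⊕ binomial (n ∸ n₂) β₂ ⊕ binomial (n ∸ t) (gsum t emptyWeight)

glue : ℕ → Profile → Profile → Profile
glue t P Q = profile n (glue-b t n (vertices P) (vertices Q) (bseq P) (bseq Q))
  where n = vertices P + vertices Q ∸ t

glue-cong : ∀ t {P P′ Q Q′} → P ≈ P′ → Q ≈ Q′ → glue t P Q ≈ glue t P′ Q′
glue-cong t {P′ = P′} {Q′ = Q′} (refl , β₁) (refl , β₂) =
  refl , λ k → cong₂ _+ℤ_ (cong₂ _+ℤ_ (binomial-cong (n ∸ vertices P′) β₁ k)
                                      (binomial-cong (n ∸ vertices Q′) β₂ k)) refl
  where n = vertices P′ + vertices Q′ ∸ t

connected-sum-profile : ∀ {t G₁ G₂ G} → IsConnSum t G₁ G₂ G →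
  profileOf G ≈ glue t (profileOf G₁) (profileOf G₂)
connected-sum-profile {t} {G₁} {G₂} {G} cs = size≡ , λ k →
  trans (b-decomposition k)
        (cong (λ n → glue-b t n (size G₁) (size G₂) (λ j → b j G₁) (λ j → b j G₂) k) size≡)
  where
  open ConnectedSum cs
  size≡ : size G ≡ size G₁ + size G₂ ∸ t
  size≡ = trans (sym (m+n∸n≡m (size G) t)) (cong (_∸ t) vertex-count)

≈-refl : ∀ {P} → P ≈ P
≈-refl = refl , λ _ → refl

≈-trans : ∀ {P Q R} → P ≈ Q → Q ≈ R → P ≈ R
≈-trans (v₁ , β₁) (v₂ , β₂) = trans v₁ v₂ , λ k → trans (β₁ k) (β₂ k)

-- The profile of a t-connected sum of G₁, …, Gₙ, folded from the left (the
-- value on the empty list, which has no connected sum, is immaterial).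
combined : ℕ → List Graph → Profile
combined t []       = profile 0 (λ _ → + 0)
combined t (G ∷ Gs) = foldl (λ P H → glue t P (profileOf H)) (profileOf G) Gs

combined-∷ʳ : ∀ t Gs H → Gs ≢ [] → combined t (Gs ∷ʳ H) ≡ glue t (combined t Gs) (profileOf H)
combined-∷ʳ t []       H nonempty = ⊥-elim (nonempty refl)
combined-∷ʳ t (G ∷ Gs) H _        = foldl-∷ʳ (λ P H → glue t P (profileOf H)) (profileOf G) H Gs

summands-nonempty : ∀ {t Gs G} → IsConnSumOf t Gs G → Gs ≢ []
summands-nonempty (single _)          ()
summands-nonempty (step {[]}    _ _) ()
summands-nonempty (step {_ ∷ _} _ _) ()

profile-of-sum : ∀ {t Gs G} → IsConnSumOf t Gs G → profileOf G ≈ combined t Gs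
profile-of-sum (single G₁) = ≈-refl
profile-of-sum {t} {G = G} (step {Gs} {Gᵢ = Gᵢ} d cs) =
  subst (profileOf G ≈_) (sym (combined-∷ʳ t Gs Gᵢ (summands-nonempty d)))
        (≈-trans (connected-sum-profile cs) (glue-cong t (profile-of-sum d) ≈-refl))

corollary3p3 : (t : ℕ) → t ≥ 1 → (Gs : List Graph) → (G H : Graph) →
    IsConnSumOf t Gs G → IsConnSumOf t Gs H → (k : ℕ) → b k G ≡ b k H
corollary3p3 t _ Gs G H sumG sumH k =
  trans (proj₂ (profile-of-sum sumG) k) (sym (proj₂ (profile-of-sum sumH) k))
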